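{- Let $n\ge4$, $A\in\mathbb{Z}^{n\times n}$, and let $\Phi(A)$ and $h=h(A)$ be as in the context. Then (1) $h\mid b-c$ for every $(b,c)\in\Phi(A)$, and (2) $(h,-h)\in\Phi(A)$.
   Context: $(A^\sigma)_{ij}=A_{\sigma(i)\sigma(j)}$ for $\sigma\in S_n$. $\Phi(A)\subseteq\mathbb{Z}^2$ is the $\mathbb{Z}$-module generated by $\big((A^\pi)_{13}-(A^\pi)_{23}-(A^\pi)_{14}+(A^\pi)_{24},\ (A^\pi)_{31}-(A^\pi)_{32}-(A^\pi)_{41}+(A^\pi)_{42}\big)$, $\pi\in S_n$. $h(A)=\gcd\{(A^\pi)_{12}+(A^\pi)_{23}+(A^\pi)_{31}-(A^\pi)_{21}-(A^\pi)_{32}-(A^\pi)_{13}:\pi\in S_n\}$, i.e. the gcd of $A_{ij}+A_{jk}+A_{ki}-A_{ji}-A_{kj}-A_{ik}$ over distinct $i,j,k$. -}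

module Defs where

open import Data.Nat using (ℕ)
open import Data.Fin using (Fin; zero; suc; _≟_)
open import Data.Nat using () renaming (suc to sucℕ)
open import Data.Fin.Permutation using (Permutation′; _⟨$⟩ʳ_)
open import Data.Integer using (ℤ; _+_; _-_; _*_; 0ℤ)
open import Data.Integer.GCD using (gcd)
open import Data.List using (List; []; _∷_; allFin; concatMap; foldr)
open import Data.Product using (_×_; _,_; ∃)
open import Data.Bool using (if_then_else_; _∨_)
open import Relation.Nullary.Decidable using (does)
open import Relation.Binary.PropositionalEquality using (_≡_)

Matrix : ℕ → Set
Matrix n = Fin n → Fin n → ℤ

_^perm_ : ∀ {n} → Matrix n → Permutation′ n → Matrix n
(A ^perm σ) i j = A (σ ⟨$⟩ʳ i) (σ ⟨$⟩ʳ j)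

-- the generator of Φ(A) associated with π (indices 1,2,3,4 ↦ Fin 0,1,2,3; needs n ≥ 4)
phiGen : ∀ {m} → Matrix (sucℕ (sucℕ (sucℕ (sucℕ m)))) → Permutation′ (sucℕ (sucℕ (sucℕ (sucℕ m)))) → ℤ × ℤ
phiGen {m} A π =
  ( B i1 i3 - B i2 i3 - B i1 i4 + B i2 i4
  , B i3 i1 - B i3 i2 - B i4 i1 + B i4 i2 )
  where
  B = A ^perm π
  i1 i2 i3 i4 : Fin (sucℕ (sucℕ (sucℕ (sucℕ m))))
  i1 = zero
  i2 = suc zero
  i3 = suc (suc zero)
  i4 = suc (suc (suc zero))

lincomb : List (ℤ × (ℤ × ℤ)) → ℤ × ℤ
lincomb [] = (0ℤ , 0ℤ)
lincomb ((k , (x , y)) ∷ rest) with lincomb rest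
... | (u , v) = (k * x + u , k * y + v)

_∈Φ_ : ∀ {m} → ℤ × ℤ → Matrix (sucℕ (sucℕ (sucℕ (sucℕ m)))) → Set
_∈Φ_ {m} bc A =
  ∃ λ (L : List (ℤ × Permutation′ (sucℕ (sucℕ (sucℕ (sucℕ m)))))) →
    lincomb (Data.List.map (λ { (k , π) → (k , phiGen A π) }) L) ≡ bc

cyc : ∀ {n} → Matrix n → Fin n → Fin n → Fin n → ℤ
cyc A i j k = A i j + A j k + A k i - A j i - A k j - A i k

cycValues : ∀ {n} → Matrix n → List ℤ
cycValues {n} A =
  concatMap (λ i → concatMap (λ j → concatMap (λ k →
    if does (i ≟ j) ∨ does (j ≟ k) ∨ does (i ≟ k) then [] else (cyc A i j k ∷ []))
    (allFin n)) (allFin n)) (allFin n)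

-- h(A) = gcd of those values (gcd of the empty list is 0); a nonnegative integer
h : ∀ {n} → Matrix n → ℤ
h A = foldr gcd 0ℤ (cycValues A)

-- For a generator at π, with a b c d = π(1) … π(4), the difference of its coordinates is
-- cyc(a,b,d) - cyc(a,b,c), so h divides b - c on all of Φ(A). Conversely, for distinct i j k
-- three generators combine to (cyc(i,j,k), -cyc(i,j,k)); since the x with (x, -x) ∈ Φ(A) form
-- an ideal of ℤ, Bézout puts the gcd h of these values in it as well.

module Submission where

open import Defs
open import Data.Nat using (ℕ; suc)
open import Data.Integer using (ℤ; _-_; -_)
open import Data.Integer.Divisibility using (_∣_)
open import Data.Product using (_×_; _,_)

import Data.Nat as ℕ
import Data.Nat.GCD as ℕ
open import Data.Integer using (_+_; _*_; 0ℤ; 1ℤ; +_; ∣_∣)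
open import Data.Integer.Properties
  using (+-assoc; +-comm; +-identityˡ; *-assoc; *-zeroʳ; *-distribˡ-+; pos-+; pos-*; +∣i∣≡i⊎+∣i∣≡-i)
import Data.Integer.Divisibility.Signed as Signed
open import Data.Integer.GCD using (gcd; gcd[i,j]∣i; gcd[i,j]∣j)
open import Data.Integer.Tactic.RingSolver using (solve-∀)
open import Data.Fin using (Fin; _≟_; punchIn; punchOut)
open import Data.Fin.Patterns using (0F; 1F; 2F; 3F)
open import Data.Fin.Properties using (punchIn-punchOut; punchOut-injective)
open import Data.Fin.Permutation using (Permutation′; _⟨$⟩ʳ_; insert; id; transpose; _∘ₚ_)
open import Data.List using (List; []; _∷_; _++_; map; foldr; concatMap; allFin)
open import Data.List.Properties using (map-++)
open import Data.List.Membership.Propositional using (_∈_; lose)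
open import Data.List.Membership.Propositional.Properties using (∈-allFin; ∈-concatMap⁺; ∈-concatMap⁻)
open import Data.List.Relation.Unary.Any using (here; there; satisfied)
open import Data.Product using (∃; ∃₂)
open import Data.Sum using (inj₁; inj₂)
open import Data.Bool using (if_then_else_; _∨_)
open import Relation.Nullary using (no; does)
open import Relation.Nullary.Decidable using (dec-false)
open import Relation.Binary.PropositionalEquality
open import Function using (_∘_)
open import Function.Bundles using (Injection)
open import Function.Properties.Inverse using (↔⇒↣)

LinearlyClosed : (ℤ → Set) → Set
LinearlyClosed I = ∀ s t {x y} → I x → I y → I (s * x + t * y)

ℕ-Bézout⇒ℤ : ∀ d m n x y → d ℕ.+ y ℕ.* n ≡ x ℕ.* m → + d ≡ + x * + m + - + y * + n
ℕ-Bézout⇒ℤ d m n x y eq = begin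
  + d                              ≡⟨ add-sub (+ d) (+ y * + n) ⟩
  + d + + y * + n - + y * + n      ≡⟨ cong (_- + y * + n) lifted ⟩
  + x * + m - + y * + n            ≡⟨ sub-as-add (+ x * + m) (+ y) (+ n) ⟩
  + x * + m + - + y * + n          ∎
  where
  open ≡-Reasoning
  add-sub : ∀ a b → a ≡ a + b - b
  add-sub = solve-∀
  sub-as-add : ∀ a b c → a - b * c ≡ a + - b * c
  sub-as-add = solve-∀
  lifted : + d + + y * + n ≡ + x * + m
  lifted = begin
    + d + + y * + n    ≡⟨ cong (λ w → + d + w) (pos-* y n) ⟨
    + d + + (y ℕ.* n)  ≡⟨ pos-+ d (y ℕ.* n) ⟨
    + (d ℕ.+ y ℕ.* n)  ≡⟨ cong +_ eq ⟩
    + (x ℕ.* m)        ≡⟨ pos-* x m ⟩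
    + x * + m          ∎

gcd-Bézout : ∀ i j → ∃₂ λ s t → gcd i j ≡ s * + ∣ i ∣ + t * + ∣ j ∣
gcd-Bézout i j with ℕ.Bézout.identity (ℕ.gcd-GCD ∣ i ∣ ∣ j ∣)
... | ℕ.Bézout.Identity.+- x y eq = + x , - + y , ℕ-Bézout⇒ℤ _ ∣ i ∣ ∣ j ∣ x y eq
... | ℕ.Bézout.Identity.-+ x y eq = - + x , + y , trans (ℕ-Bézout⇒ℤ _ ∣ j ∣ ∣ i ∣ y x eq) (+-comm (+ y * + ∣ j ∣) (- + x * + ∣ i ∣))

module _ {I : ℤ → Set} (closed : LinearlyClosed I) where

  closed-neg : ∀ {x} → I x → I (- x)
  closed-neg {x} Ix = subst I (neg x) (closed (- 1ℤ) 0ℤ Ix Ix)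
    where
    neg : ∀ x → - 1ℤ * x + 0ℤ * x ≡ - x
    neg = solve-∀

  closed-abs : ∀ {x} → I x → I (+ ∣ x ∣)
  closed-abs {x} Ix with +∣i∣≡i⊎+∣i∣≡-i x
  ... | inj₁ eq = subst I (sym eq) Ix
  ... | inj₂ eq = subst I (sym eq) (closed-neg Ix)

  closed-gcd : ∀ {x y} → I x → I y → I (gcd x y)
  closed-gcd {x} {y} Ix Iy with gcd-Bézout x y
  ... | s , t , eq = subst I (sym eq) (closed s t (closed-abs Ix) (closed-abs Iy))

  closed-foldr-gcd : I 0ℤ → ∀ {xs} → (∀ {x} → x ∈ xs → I x) → I (foldr gcd 0ℤ xs)
  closed-foldr-gcd I0 {[]}     _   = I0
  closed-foldr-gcd I0 {x ∷ xs} Ixs = closed-gcd (Ixs (here refl)) (closed-foldr-gcd I0 (Ixs ∘ there))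

foldr-gcd-∣ : ∀ {x xs} → x ∈ xs → foldr gcd 0ℤ xs Signed.∣ x
foldr-gcd-∣ {xs = x ∷ xs} (here refl) = Signed.∣ᵤ⇒∣ (gcd[i,j]∣i x (foldr gcd 0ℤ xs))
foldr-gcd-∣ {xs = y ∷ xs} (there x∈) =
  Signed.∣-trans (Signed.∣ᵤ⇒∣ (gcd[i,j]∣j y (foldr gcd 0ℤ xs))) (foldr-gcd-∣ x∈)

infixl 6 _⊕_
infixr 7 _·_

_⊕_ : ℤ × ℤ → ℤ × ℤ → ℤ × ℤ
(a , b) ⊕ (c , d) = a + c , b + d

_·_ : ℤ → ℤ × ℤ → ℤ × ℤ
s · (a , b) = s * a , s * b

diff : ℤ × ℤ → ℤ
diff (b , c) = b - c

scaleCoeffs : {A : Set} → ℤ → List (ℤ × A) → List (ℤ × A)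
scaleCoeffs s = map (λ { (k , a) → s * k , a })

lincomb-++ : ∀ xs ys → lincomb (xs ++ ys) ≡ lincomb xs ⊕ lincomb ys
lincomb-++ [] ys = sym (cong₂ _,_ (+-identityˡ _) (+-identityˡ _))
lincomb-++ ((k , (x , y)) ∷ xs) ys rewrite lincomb-++ xs ys =
  cong₂ _,_ (sym (+-assoc (k * x) _ _)) (sym (+-assoc (k * y) _ _))

lincomb-scale : ∀ s xs → lincomb (scaleCoeffs s xs) ≡ s · lincomb xs
lincomb-scale s [] = sym (cong₂ _,_ (*-zeroʳ s) (*-zeroʳ s))
lincomb-scale s ((k , (x , y)) ∷ xs) rewrite lincomb-scale s xs =
  cong₂ _,_ (distrib x _) (distrib y _)
  where
  distrib : ∀ a u → s * k * a + s * u ≡ s * (k * a + u)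
  distrib a u = trans (cong (_+ s * u) (*-assoc s k a)) (sym (*-distribˡ-+ s (k * a) u))

diff-linear : ∀ k v w → diff (k · v ⊕ w) ≡ k * diff v + diff w
diff-linear k (x , y) (u , z) = linear k x y u z
  where
  linear : ∀ k x y u z → (k * x + u) - (k * y + z) ≡ k * (x - y) + (u - z)
  linear = solve-∀

module Span {P : Set} (g : P → ℤ × ℤ) where

  terms : List (ℤ × P) → List (ℤ × (ℤ × ℤ))
  terms = map (λ { (k , p) → k , g p })

  _∈Span : ℤ × ℤ → Set
  v ∈Span = ∃ λ L → lincomb (terms L) ≡ v

  terms-scale : ∀ s L → terms (scaleCoeffs s L) ≡ scaleCoeffs s (terms L)
  terms-scale s []      = refl
  terms-scale s (_ ∷ L) = cong (_ ∷_) (terms-scale s L)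

  ∈Span-⊕ : ∀ {u v} → u ∈Span → v ∈Span → (u ⊕ v) ∈Span
  ∈Span-⊕ (L , refl) (M , refl) =
    L ++ M , trans (cong lincomb (map-++ _ L M)) (lincomb-++ (terms L) (terms M))

  ∈Span-· : ∀ s {v} → v ∈Span → (s · v) ∈Span
  ∈Span-· s (L , refl) =
    scaleCoeffs s L , trans (cong lincomb (terms-scale s L)) (lincomb-scale s (terms L))

  ∈Span-∣-diff : ∀ {d v} → (∀ p → d Signed.∣ diff (g p)) → v ∈Span → d Signed.∣ diff v
  ∈Span-∣-diff {d} d∣gen (L , refl) = ∣-diff L
    where
    ∣-diff : ∀ L → d Signed.∣ diff (lincomb (terms L))
    ∣-diff []            = Signed.divides 0ℤ refl
    ∣-diff ((k , p) ∷ L) = subst (d Signed.∣_) (sym (diff-linear k (g p) (lincomb (terms L))))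
      (Signed.∣m∣n⇒∣m+n (Signed.∣n⇒∣m*n k (d∣gen p)) (∣-diff L))

  AntiDiagonal : ℤ → Set
  AntiDiagonal x = (x , - x) ∈Span

  antiDiagonal-0 : AntiDiagonal 0ℤ
  antiDiagonal-0 = [] , refl

  antiDiagonal-closed : LinearlyClosed AntiDiagonal
  antiDiagonal-closed s t {x} {y} Ax Ay =
    subst _∈Span (cong (s * x + t * y ,_) (neg-linear s t x y)) (∈Span-⊕ (∈Span-· s Ax) (∈Span-· t Ay))
    where
    neg-linear : ∀ s t x y → s * - x + t * - y ≡ - (s * x + t * y)
    neg-linear = solve-∀

-- The nesting levels of cycValues, so that cycValues A is concatMap (cycValues₁ A) (allFin n).
cycValues₃ : ∀ {n} → Matrix n → Fin n → Fin n → Fin n → List ℤ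
cycValues₃ A i j k = if does (i ≟ j) ∨ does (j ≟ k) ∨ does (i ≟ k) then [] else cyc A i j k ∷ []

cycValues₂ : ∀ {n} → Matrix n → Fin n → Fin n → List ℤ
cycValues₂ {n} A i j = concatMap (cycValues₃ A i j) (allFin n)

cycValues₁ : ∀ {n} → Matrix n → Fin n → List ℤ
cycValues₁ {n} A i = concatMap (cycValues₂ A i) (allFin n)

cyc-∈-cycValues : ∀ {n} (A : Matrix n) {i j k} → i ≢ j → j ≢ k → i ≢ k → cyc A i j k ∈ cycValues A
cyc-∈-cycValues A {i} {j} {k} i≢j j≢k i≢k =
  ∈-concatMap⁺ (cycValues₁ A) (lose (∈-allFin i)
    (∈-concatMap⁺ (cycValues₂ A i) (lose (∈-allFin j) (∈-concatMap⁺ (cycValues₃ A i j) (lose (∈-allFin k) kept)))))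
  where
  kept : cyc A i j k ∈ cycValues₃ A i j k
  kept rewrite dec-false (i ≟ j) i≢j | dec-false (j ≟ k) j≢k | dec-false (i ≟ k) i≢k = here refl

cycValues-ind : ∀ {n} (A : Matrix n) (Q : ℤ → Set) →
  (∀ {i j k} → i ≢ j → j ≢ k → i ≢ k → Q (cyc A i j k)) → ∀ {x} → x ∈ cycValues A → Q x
cycValues-ind {n} A Q Qcyc x∈
  with i , x∈ᵢ ← satisfied (∈-concatMap⁻ (cycValues₁ A) {allFin n} x∈)
  with j , x∈ⱼ ← satisfied (∈-concatMap⁻ (cycValues₂ A i) {allFin n} x∈ᵢ)
  with k , x∈ₖ ← satisfied (∈-concatMap⁻ (cycValues₃ A i j) {allFin n} x∈ⱼ)
  with i ≟ j | j ≟ k | i ≟ k | x∈ₖ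
... | no i≢j | no j≢k | no i≢k | here refl = Qcyc i≢j j≢k i≢k

permutation-with-prefix : ∀ {n} {i j k : Fin (suc (suc (suc n)))} → i ≢ j → j ≢ k → i ≢ k →
  ∃ λ π → π ⟨$⟩ʳ 0F ≡ i × π ⟨$⟩ʳ 1F ≡ j × π ⟨$⟩ʳ 2F ≡ k
permutation-with-prefix {i = i} i≢j j≢k i≢k =
  insert 0F i (insert 0F j′ (insert 0F k′ id)) , refl , punchIn-punchOut i≢j ,
  trans (cong (punchIn i) (punchIn-punchOut j′≢k″)) (punchIn-punchOut i≢k)
  where
  j′ = punchOut i≢j
  k″ = punchOut i≢k
  j′≢k″ : j′ ≢ k″
  j′≢k″ = j≢k ∘ punchOut-injective i≢j i≢k
  k′ = punchOut j′≢k″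

permute-≢ : ∀ {n} (π : Permutation′ n) {x y} → x ≢ y → π ⟨$⟩ʳ x ≢ π ⟨$⟩ʳ y
permute-≢ π x≢y = x≢y ∘ Injection.injective (↔⇒↣ π)

module _ {m} (A : Matrix (suc (suc (suc (suc m))))) where
  open Span (phiGen A)

  h-∣-cyc : ∀ {i j k} → i ≢ j → j ≢ k → i ≢ k → h A Signed.∣ cyc A i j k
  h-∣-cyc i≢j j≢k i≢k = foldr-gcd-∣ (cyc-∈-cycValues A i≢j j≢k i≢k)

  h-∣-diff-phiGen : ∀ π → h A Signed.∣ diff (phiGen A π)
  h-∣-diff-phiGen π = subst (h A Signed.∣_)
    (sym (two-cycles (A a c) (A b c) (A a d) (A b d) (A c a) (A c b) (A d a) (A d b) (A a b) (A b a)))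
    (Signed.∣m∣n⇒∣m-n (h-∣-cyc (distinct λ ()) (distinct λ ()) (distinct λ ())) (h-∣-cyc (distinct λ ()) (distinct λ ()) (distinct λ ())))
    where
    a = π ⟨$⟩ʳ 0F
    b = π ⟨$⟩ʳ 1F
    c = π ⟨$⟩ʳ 2F
    d = π ⟨$⟩ʳ 3F
    distinct : ∀ {x y} → x ≢ y → π ⟨$⟩ʳ x ≢ π ⟨$⟩ʳ y
    distinct = permute-≢ π
    two-cycles : ∀ ac bc ad bd ca cb da db ab ba →
      (ac - bc - ad + bd) - (ca - cb - da + db) ≡
      (ab + bd + da - ba - db - ad) - (ab + bc + ca - ba - cb - ac)
    two-cycles = solve-∀

  -- In 1-based positions: the generators at π, π ∘ (2 3) and π ∘ (1 2 3),
  -- with coefficients -1, 1, -1, sum to (cyc A p q r , - cyc A p q r).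
  cyc-antiDiagonal-at : ∀ π → AntiDiagonal (cyc A (π ⟨$⟩ʳ 0F) (π ⟨$⟩ʳ 1F) (π ⟨$⟩ʳ 2F))
  cyc-antiDiagonal-at π =
    (- 1ℤ , π) ∷ (1ℤ , transpose 1F 2F ∘ₚ π) ∷ (- 1ℤ , (transpose 1F 2F ∘ₚ transpose 0F 1F) ∘ₚ π) ∷ [] ,
    cong₂ _,_
      (first (A p q) (A p r) (A p s) (A q p) (A q r) (A q s) (A r p) (A r q) (A r s))
      (second (A p q) (A p r) (A q p) (A q r) (A r p) (A r q) (A s p) (A s q) (A s r))
    where
    p = π ⟨$⟩ʳ 0F
    q = π ⟨$⟩ʳ 1F
    r = π ⟨$⟩ʳ 2F
    s = π ⟨$⟩ʳ 3F
    first : ∀ pq pr ps qp qr qs rp rq rs →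
      - 1ℤ * (pr - qr - ps + qs) + (1ℤ * (pq - rq - ps + rs) + (- 1ℤ * (qp - rp - qs + rs) + 0ℤ))
      ≡ pq + qr + rp - qp - rq - pr
    first = solve-∀
    second : ∀ pq pr qp qr rp rq sp sq sr →
      - 1ℤ * (rp - rq - sp + sq) + (1ℤ * (qp - qr - sp + sr) + (- 1ℤ * (pq - pr - sq + sr) + 0ℤ))
      ≡ - (pq + qr + rp - qp - rq - pr)
    second = solve-∀

  cyc-antiDiagonal : ∀ {i j k} → i ≢ j → j ≢ k → i ≢ k → AntiDiagonal (cyc A i j k)
  cyc-antiDiagonal i≢j j≢k i≢k
    with π , refl , refl , refl ← permutation-with-prefix i≢j j≢k i≢k = cyc-antiDiagonal-at π

lemma4p3 : (m : ℕ) (A : Matrix (suc (suc (suc (suc m))))) →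
    ((b c : ℤ) → (b , c) ∈Φ A → h A ∣ (b - c))
    × ((h A , - h A) ∈Φ A)
lemma4p3 m A =
  (λ b c → Signed.∣⇒∣ᵤ ∘ ∈Span-∣-diff (h-∣-diff-phiGen A)) ,
  closed-foldr-gcd antiDiagonal-closed antiDiagonal-0 (cycValues-ind A AntiDiagonal (cyc-antiDiagonal A))
  where open Span (phiGen A)
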